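{- Let $V$ be a finite vertex set, $r\in V$, and let $H$ and $D$ be digraphs on $V$ (parallel edges allowed, no loops; edges are distinct objects so that $E(D)\setminus E(H)$ is meaningful), where no edge of $H$ or $D$ has head $r$. Assume that $\lambda_H(r,u)<\lambda_D(r,u)$ for some $u\in V-r$. Then there is an edge $e\in E(D)\setminus E(H)$, with head $v$ say, such that $e$ is a coloop of $\mathcal{G}_{H+e}(v)$, i.e. \[ \mathcal{G}_{H+e}(v)\supseteq\{ I\cup\{e\} : I\in \mathcal{G}_{H}(v) \}. \]
   Context: For a digraph $G$ on $V$ and $w\in V-r$, $\lambda_G(r,w)$ is the maximal number of pairwise edge-disjoint directed $r\to w$ paths in $G$. $H+e$ denotes the digraph obtained from $H$ by adding the edge $e$. For $w\in V-r$, $\mathcal{G}_G(w)$ is the family of those sets $I$ of edges of $G$ with head $w$ for which there exists a system of pairwise edge-disjoint $r\to w$ paths in $G$ whose set of last edges is exactly $I$ (this is the family of independent sets of a matroid on the in-edges of $w$). -}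

module Defs where

open import Data.Nat using (ℕ; _<_)
open import Data.Fin using (Fin)
open import Data.Fin.Subset using (Subset; _∈_; _∉_; _∪_; ⁅_⁆)
open import Data.List using (List; []; _∷_; _++_; length)
open import Data.List.Relation.Unary.All using (All)
open import Data.List.Relation.Unary.Any using (Any)
open import Data.List.Relation.Unary.AllPairs using (AllPairs)
open import Data.List.Relation.Unary.Unique.Propositional using (Unique)
open import Data.List.Relation.Binary.Disjoint.Propositional using (Disjoint)
open import Data.Product using (Σ; _×_; ∃)
open import Function.Bundles using (_⇔_)
open import Relation.Binary.PropositionalEquality using (_≡_)

-- A common universe of edges (distinct objects) over the vertex set Fin n.
-- Every edge has a tail and a head. A digraph on V is a subset of the edges.
record EdgeUniverse (n : ℕ) : Set where
  field
    m    : ℕ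
    tl   : Fin m → Fin n
    hd   : Fin m → Fin n

module _ {n : ℕ} (U : EdgeUniverse n) where
  open EdgeUniverse U

  Edge : Set
  Edge = Fin m

  Digraph : Set
  Digraph = Subset m

  Loopless : Digraph → Set
  Loopless G = ∀ e → e ∈ G → tl e ≡ hd e → Data.Empty.⊥
    where import Data.Empty

  NoHeadAt : Fin n → Digraph → Set
  NoHeadAt r G = ∀ e → e ∈ G → hd e ≡ r → Data.Empty.⊥
    where import Data.Empty

  data Walk (G : Digraph) : Fin n → Fin n → List Edge → Set where
    here : ∀ {v} → Walk G v v []
    step : ∀ {u w e es} → e ∈ G → tl e ≡ u → Walk G (hd e) w es → Walk G u w (e ∷ es)

  verts : Fin n → List Edge → List (Fin n)
  verts u []       = u ∷ []
  verts u (e ∷ es) = u ∷ verts (hd e) es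

  Path : Digraph → Fin n → Fin n → List Edge → Set
  Path G r w es = Walk G r w es × Unique (verts r es)

  DisjointPaths : Digraph → Fin n → Fin n → List (List Edge) → Set
  DisjointPaths G r w ps = All (Path G r w) ps × AllPairs Disjoint ps

  IsLastEdge : Edge → List Edge → Set
  IsLastEdge f p = ∃ λ pre → p ≡ pre ++ (f ∷ [])

  IsLambda : Digraph → Fin n → Fin n → ℕ → Set
  IsLambda G r w k =
    (∃ λ ps → DisjointPaths G r w ps × length ps ≡ k) ×
    (∀ ps → DisjointPaths G r w ps → length ps Data.Nat.≤ k)
    where import Data.Nat

  InG : Digraph → Fin n → Fin n → Subset m → Set
  InG G r w I =
    (∀ f → f ∈ I → f ∈ G × hd f ≡ w) ×
    (∃ λ ps → DisjointPaths G r w ps × (∀ f → (f ∈ I) ⇔ Any (IsLastEdge f) ps))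

module Submission where

-- Let P₀ be a maximum system of k = λ_H(r,u) edge-disjoint r→u paths in H and X the set of
-- vertices reachable from r in its residual graph. Then u ∉ X and every edge of H leaving X lies
-- on P₀, so at most k edges of H leave X; the l > k paths of D must therefore leave X through
-- an edge e ∉ H, with tail t ∈ X and head v ∉ X.
-- Given paths to v with last edges I, augment them inside H while v is reachable in their
-- residual graph; augmenting keeps all last edges. Once v is unreachable, with reachable set Y,
-- submodularity of the cut function makes X ∩ Y a cut saturated by P₀, so X ∩ Y is closed in
-- the residual graph of P₀ and X ⊆ Y. Hence t ∈ Y, and the residual walk to t followed by e
-- augments the system in H + e with e as a new last edge; discarding the paths whose last edge
-- lies outside I ∪ {e} leaves last edges exactly I ∪ {e}.

open import Defs
open import Data.Nat using (ℕ; zero; suc; _+_; _*_; _≤_; _<_; _≤ᵇ_; z≤n; s≤s)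
open import Data.Nat.Properties hiding (_≟_)
open import Data.Nat.Tactic.RingSolver using (solve-∀)
open import Algebra.Properties.CommutativeSemigroup +-commutativeSemigroup
  using (interchange; x∙yz≈y∙xz; xy∙z≈z∙yx)
open import Data.Bool using (Bool; true; false; not; _∧_; _∨_; T)
open import Data.Fin using (Fin; _≟_)
open import Data.Fin.Subset using (Subset; _∈_; _∉_; _∪_; ⁅_⁆)
open import Data.Fin.Subset.Properties using (_∈?_; p⊆p∪q; q⊆p∪q; x∈p∪q⁻; x∈⁅x⁆; x∈⁅y⁆⇒x≡y)
open import Data.List using (List; []; _∷_; _++_; length; concat; filter; allFin; map; initLast; _∷ʳ′_)
open import Data.Bool.ListAction using (any)
open import Data.List.Membership.Propositional
  using (find; lose) renaming (_∈_ to _∈ₗ_; _∉_ to _∉ₗ_)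
open import Data.List.Relation.Binary.Subset.Propositional using () renaming (_⊆_ to _⊆ₗ_)
open import Data.List.Properties using (∷ʳ-injectiveʳ; ++-identityʳ; length-++; length-++-sucʳ; length-tabulate)
open import Data.List.Membership.Propositional.Properties
  using (∈-++⁺ˡ; ∈-++⁺ʳ; ∈-++⁻; ∈-∃++; ∈-allFin; ∈-map⁺; ∈-filter⁺; ∈-filter⁻; ∈-concat⁺′; ∈-concat⁻′)
open import Data.List.Relation.Unary.All as All using (All; []; _∷_)
open import Data.List.Relation.Unary.All.Properties using (¬Any⇒All¬; anti-mono)
import Data.List.Relation.Unary.All.Properties as All
open import Data.List.Relation.Unary.Any using (Any; here; there)
open import Data.List.Relation.Unary.Any.Properties using (¬Any[])
open import Data.List.Relation.Unary.AllPairs using (AllPairs; []; _∷_)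
import Data.List.Relation.Unary.AllPairs.Properties as AllPairs
open import Data.List.Relation.Unary.Unique.Propositional using (Unique)
import Data.List.Relation.Unary.Unique.Propositional.Properties as Unique
open import Data.List.Relation.Binary.Disjoint.Propositional using (Disjoint)
import Data.Product
open import Data.Product using (_×_; _,_; proj₁; proj₂; ∃)
open import Data.Sum using (_⊎_; inj₁; inj₂; [_,_])
open import Function using (_∘_; id)
open import Function.Bundles using (Equivalence; mk⇔)
open import Data.Empty using (⊥; ⊥-elim)
open import Relation.Nullary using (¬_; Dec; yes; no; does)
open import Relation.Nullary.Decidable using (dec-true; dec-false; _×-dec_; ¬?)
open import Relation.Unary using (Decidable)
open import Relation.Binary.PropositionalEquality hiding ([_])

does⇒ : ∀ {A : Set} (a? : Dec A) → does a? ≡ true → A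
does⇒ (yes a) _ = a

does⇒¬ : ∀ {A : Set} (a? : Dec A) → does a? ≡ false → ¬ A
does⇒¬ (no ¬a) _ = ¬a

∧-true⁻ : ∀ {a b} → a ∧ b ≡ true → a ≡ true × b ≡ true
∧-true⁻ {true} {true} _ = refl , refl

∧-true⁺ : ∀ {a b} → a ≡ true → b ≡ true → a ∧ b ≡ true
∧-true⁺ refl refl = refl

∨-true⁻ : ∀ {a b} → a ∨ b ≡ true → a ≡ true ⊎ b ≡ true
∨-true⁻ {true}  _ = inj₁ refl
∨-true⁻ {false} b = inj₂ b

not-true⁻ : ∀ {a} → not a ≡ true → a ≡ false
not-true⁻ {false} _ = refl

_==_ : ∀ {n} → Fin n → Fin n → Bool
x == y = does (x ≟ y)

𝟙 : Bool → ℕ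
𝟙 true  = 1
𝟙 false = 0

δ : ∀ {n} → Fin n → Fin n → ℕ
δ a y = 𝟙 (a == y)

-- On edges this is definitionally IsLastEdge U, so the two are used interchangeably.
IsLast : {A : Set} → A → List A → Set
IsLast {A} x xs = ∃ λ (pre : List A) → xs ≡ pre ++ x ∷ []

IsLast-unique : {A : Set} {x y : A} {xs : List A} → IsLast x xs → IsLast y xs → x ≡ y
IsLast-unique (pre , refl) (pre′ , eq) = ∷ʳ-injectiveʳ pre pre′ eq

IsLast⇒∈ : {A : Set} {x : A} {xs : List A} → IsLast x xs → x ∈ₗ xs
IsLast⇒∈ (pre , refl) = ∈-++⁺ʳ pre (here refl)

count : {A : Set} → (A → Bool) → List A → ℕ
count p []       = 0
count p (x ∷ xs) = 𝟙 (p x) + count p xs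

module _ {A : Set} where

  ∈-skip⁺ : ∀ xs {g : A} {ys z} → z ∈ₗ xs ++ ys → z ∈ₗ xs ++ g ∷ ys
  ∈-skip⁺ xs z∈ with ∈-++⁻ xs z∈
  ... | inj₁ z∈xs = ∈-++⁺ˡ z∈xs
  ... | inj₂ z∈ys = ∈-++⁺ʳ xs (there z∈ys)

  ∈-skip⁻ : ∀ xs {g : A} {ys z} → z ∈ₗ xs ++ g ∷ ys → z ≡ g ⊎ z ∈ₗ xs ++ ys
  ∈-skip⁻ xs z∈ with ∈-++⁻ xs z∈
  ... | inj₁ z∈xs          = inj₂ (∈-++⁺ˡ z∈xs)
  ... | inj₂ (here z≡g)    = inj₁ z≡g
  ... | inj₂ (there z∈ys)  = inj₂ (∈-++⁺ʳ xs z∈ys)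

  unique-skip : ∀ xs {g : A} {ys} → Unique (xs ++ g ∷ ys) → Unique (xs ++ ys) × g ∉ₗ xs ++ ys
  unique-skip [] (g∉ys ∷ ys!) = ys! , λ g∈ys → All.lookup g∉ys g∈ys refl
  unique-skip (x ∷ xs) (x∉ ∷ xs!) with unique-skip xs xs!
  ... | xs++ys! , g∉ =
    All.tabulate (λ z∈ → All.lookup x∉ (∈-skip⁺ xs z∈)) ∷ xs++ys! ,
    λ { (here refl) → All.lookup x∉ (∈-++⁺ʳ xs (here refl)) refl ; (there g∈) → g∉ g∈ }

  length-++-∷ʳ : ∀ xs {x : A} → length (xs ++ x ∷ []) ≡ suc (length xs)
  length-++-∷ʳ xs {x} = trans (length-++-sucʳ xs x []) (cong (suc ∘ length) (++-identityʳ xs))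

  ∈⇒length>0 : ∀ {x : A} {xs} → x ∈ₗ xs → 0 < length xs
  ∈⇒length>0 (here _)  = s≤s z≤n
  ∈⇒length>0 (there _) = s≤s z≤n

  count-++ : ∀ (p : A → Bool) xs ys → count p (xs ++ ys) ≡ count p xs + count p ys
  count-++ p []       ys = refl
  count-++ p (x ∷ xs) ys rewrite count-++ p xs ys = sym (+-assoc (𝟙 (p x)) _ _)

  count-skip : ∀ (p : A → Bool) xs {g} ys → count p (xs ++ g ∷ ys) ≡ 𝟙 (p g) + count p (xs ++ ys)
  count-skip p xs {g} ys = begin
    count p (xs ++ g ∷ ys)             ≡⟨ count-++ p xs (g ∷ ys) ⟩
    count p xs + (𝟙 (p g) + count p ys) ≡⟨ x∙yz≈y∙xz (count p xs) (𝟙 (p g)) (count p ys) ⟩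
    𝟙 (p g) + (count p xs + count p ys) ≡⟨ cong (𝟙 (p g) +_) (count-++ p xs ys) ⟨
    𝟙 (p g) + count p (xs ++ ys)        ∎
    where open ≡-Reasoning

  count-true : ∀ xs → count {A} (λ _ → true) xs ≡ length xs
  count-true []       = refl
  count-true (x ∷ xs) = cong suc (count-true xs)

  count-none : ∀ {p : A → Bool} {xs} → All (λ x → p x ≡ false) xs → count p xs ≡ 0
  count-none []                = refl
  count-none (px≡false ∷ pxs) rewrite px≡false = count-none pxs

  count≡0⇒false : ∀ (p : A → Bool) xs → count p xs ≡ 0 → ∀ {x} → x ∈ₗ xs → p x ≡ false
  count≡0⇒false p (y ∷ xs) c≡0 x∈ with p y in py | x∈
  ... | false | here refl = py
  ... | false | there x∈xs = count≡0⇒false p xs c≡0 x∈xs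

  count>0⇒true : ∀ (p : A → Bool) xs → 0 < count p xs → ∃ λ x → x ∈ₗ xs × p x ≡ true
  count>0⇒true p (y ∷ xs) c>0 with p y in py
  ... | true  = y , here refl , py
  ... | false with count>0⇒true p xs c>0
  ...   | x , x∈xs , px = x , there x∈xs , px

  count-split : ∀ (q p : A → Bool) xs →
    count p xs ≡ count (λ x → q x ∧ p x) xs + count (λ x → not (q x) ∧ p x) xs
  count-split q p [] = refl
  count-split q p (x ∷ xs) with q x | p x
  ... | true  | true  = cong suc (count-split q p xs)
  ... | true  | false = count-split q p xs
  ... | false | true  = trans (cong suc (count-split q p xs)) (sym (+-suc _ _))
  ... | false | false = count-split q p xs

  count-filter : ∀ {P : A → Set} (P? : Decidable P) (p : A → Bool) xs →
    count p (filter P? xs) ≡ count (λ x → does (P? x) ∧ p x) xs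
  count-filter P? p [] = refl
  count-filter P? p (x ∷ xs) with does (P? x)
  ... | true  = cong (𝟙 (p x) +_) (count-filter P? p xs)
  ... | false = count-filter P? p xs

  count-mono₂ : ∀ (p q p′ q′ : A → Bool) xs →
    (∀ x → 𝟙 (p x) + 𝟙 (q x) ≤ 𝟙 (p′ x) + 𝟙 (q′ x)) →
    count p xs + count q xs ≤ count p′ xs + count q′ xs
  count-mono₂ p q p′ q′ [] _ = z≤n
  count-mono₂ p q p′ q′ (x ∷ xs) pointwise = begin
    (𝟙 (p x) + count p xs) + (𝟙 (q x) + count q xs)
      ≡⟨ interchange (𝟙 (p x)) (count p xs) (𝟙 (q x)) (count q xs) ⟩
    (𝟙 (p x) + 𝟙 (q x)) + (count p xs + count q xs)
      ≤⟨ +-mono-≤ (pointwise x) (count-mono₂ p q p′ q′ xs pointwise) ⟩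
    (𝟙 (p′ x) + 𝟙 (q′ x)) + (count p′ xs + count q′ xs)
      ≡⟨ interchange (𝟙 (p′ x)) (count p′ xs) (𝟙 (q′ x)) (count q′ xs) ⟨
    (𝟙 (p′ x) + count p′ xs) + (𝟙 (q′ x) + count q′ xs)   ∎
    where open ≤-Reasoning

  count-mono-unique : ∀ {p q : A → Bool} xs {ys} → Unique xs →
    (∀ {x} → x ∈ₗ xs → p x ≡ true → x ∈ₗ ys × q x ≡ true) → count p xs ≤ count q ys
  count-mono-unique [] _ _ = z≤n
  count-mono-unique {p} {q} (x ∷ xs) {ys} (x∉xs ∷ xs!) embed with p x in px
  ... | false = count-mono-unique xs xs! (λ y∈ → embed (there y∈))
  ... | true with embed (here refl) px
  ...   | x∈ys , qx with ∈-∃++ x∈ys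
  ...     | ys₁ , ys₂ , refl = begin
    1 + count p xs               ≤⟨ s≤s (count-mono-unique xs xs! embed′) ⟩
    1 + count q (ys₁ ++ ys₂)      ≡⟨ cong (λ b → 𝟙 b + count q (ys₁ ++ ys₂)) qx ⟨
    𝟙 (q x) + count q (ys₁ ++ ys₂) ≡⟨ count-skip q ys₁ ys₂ ⟨
    count q (ys₁ ++ x ∷ ys₂)     ∎
    where
    open ≤-Reasoning
    embed′ : ∀ {y} → y ∈ₗ xs → p y ≡ true → y ∈ₗ ys₁ ++ ys₂ × q y ≡ true
    embed′ y∈xs py with embed (there y∈xs) py
    ... | y∈ , qy with ∈-skip⁻ ys₁ y∈
    ...   | inj₁ refl = ⊥-elim (All.lookup x∉xs y∈xs refl)
    ...   | inj₂ y∈′  = y∈′ , qy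

  any-true⁻ : ∀ (p : A → Bool) xs → any p xs ≡ true → ∃ λ x → x ∈ₗ xs × p x ≡ true
  any-true⁻ p (y ∷ xs) h with ∨-true⁻ {p y} h
  ... | inj₁ py = y , here refl , py
  ... | inj₂ pxs with any-true⁻ p xs pxs
  ...   | x , x∈xs , px = x , there x∈xs , px

  any-true⁺ : ∀ (p : A → Bool) {x} xs → x ∈ₗ xs → p x ≡ true → any p xs ≡ true
  any-true⁺ p (y ∷ xs) (here refl) px rewrite px = refl
  any-true⁺ p (y ∷ xs) (there x∈)  px with p y
  ... | true  = refl
  ... | false = any-true⁺ p xs x∈ px

  length-mono-unique : ∀ xs {ys : List A} → Unique xs → xs ⊆ₗ ys → length xs ≤ length ys
  length-mono-unique xs {ys} xs! xs⊆ys = begin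
    length xs                ≡⟨ count-true xs ⟨
    count (λ _ → true) xs    ≤⟨ count-mono-unique xs xs! (λ x∈ _ → xs⊆ys x∈ , refl) ⟩
    count (λ _ → true) ys    ≡⟨ count-true ys ⟩
    length ys                ∎
    where open ≤-Reasoning

merge-balances : ∀ iR iW iB oR oW oB a b s t → (iB + iR) + s ≡ (oB + oR) + t → (iW + oB) + a ≡ (oW + iB) + b →
  (iR + iW) + (a + s) ≡ (oR + oW) + (b + t)
merge-balances iR iW iB oR oW oB a b s t balance₁ balance₂ = +-cancelʳ-≡ (iB + oB) _ _ (begin
  (iR + iW) + (a + s) + (iB + oB)             ≡⟨ lhs iR iW iB oB a s ⟩
  ((iB + iR) + s) + ((iW + oB) + a)           ≡⟨ cong₂ _+_ balance₁ balance₂ ⟩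
  ((oB + oR) + t) + ((oW + iB) + b)           ≡⟨ rhs oR oW oB iB b t ⟩
  (oR + oW) + (b + t) + (iB + oB)             ∎)
  where
  open ≡-Reasoning
  lhs : ∀ iR iW iB oB a s → (iR + iW) + (a + s) + (iB + oB) ≡ ((iB + iR) + s) + ((iW + oB) + a)
  lhs = solve-∀
  rhs : ∀ oR oW oB iB b t → ((oB + oR) + t) + ((oW + iB) + b) ≡ (oR + oW) + (b + t) + (iB + oB)
  rhs = solve-∀

module Arcs {n : ℕ} {L : Set} (src tgt : L → Fin n) where

  open import Data.List.Membership.DecPropositional (_≟_ {n}) using () renaming (_∈?_ to _∈ₗ?_)

  data ArcWalk (ok : L → Set) : Fin n → Fin n → List L → Set where
    here : ∀ {v} → ArcWalk ok v v []
    step : ∀ {u w l ls} → ok l → src l ≡ u → ArcWalk ok (tgt l) w ls → ArcWalk ok u w (l ∷ ls)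

  vertices : Fin n → List L → List (Fin n)
  vertices u []       = u ∷ []
  vertices u (l ∷ ls) = u ∷ vertices (tgt l) ls

  ArcPath : (L → Set) → Fin n → Fin n → List L → Set
  ArcPath ok a b ls = ArcWalk ok a b ls × Unique (vertices a ls)

  length-vertices : ∀ a ls → length (vertices a ls) ≡ suc (length ls)
  length-vertices a []       = refl
  length-vertices a (l ∷ ls) = cong suc (length-vertices (tgt l) ls)

  module _ {ok : L → Set} where

    target∈vertices : ∀ {a b ls} → ArcWalk ok a b ls → b ∈ₗ vertices a ls
    target∈vertices here           = here refl
    target∈vertices (step _ _ w) = there (target∈vertices w)

    source∈vertices : ∀ {a b ls l} → ArcWalk ok a b ls → l ∈ₗ ls → src l ∈ₗ vertices a ls
    source∈vertices (step _ sl≡a _) (here refl) = here sl≡a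
    source∈vertices (step _ _ w)    (there l∈)  = there (source∈vertices w l∈)

    walk-ok : ∀ {a b ls} → ArcWalk ok a b ls → All ok ls
    walk-ok here          = []
    walk-ok (step o _ w) = o ∷ walk-ok w

    walk-snoc : ∀ {a b ls l} → ArcWalk ok a b ls → ok l → src l ≡ b → ArcWalk ok a (tgt l) (ls ++ l ∷ [])
    walk-snoc here            o sl≡b = step o sl≡b here
    walk-snoc (step o′ e w) o sl≡b = step o′ e (walk-snoc w o sl≡b)

    walk-unsnoc : ∀ {a b ls} → ArcWalk ok a b ls →
      (ls ≡ [] × a ≡ b) ⊎ ∃ λ pre → ∃ λ l → ls ≡ pre ++ l ∷ [] × ArcWalk ok a (src l) pre × ok l × tgt l ≡ b
    walk-unsnoc here = inj₁ (refl , refl)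
    walk-unsnoc (step {l = l} o sl≡a here) = inj₂ ([] , l , refl , subst (λ v → ArcWalk ok v (src l) []) sl≡a here , o , refl)
    walk-unsnoc (step {l = l} o e (step o′ e′ w)) with walk-unsnoc (step o′ e′ w)
    ... | inj₂ (pre , l′ , ls≡ , w′ , o″ , tl′≡b) =
      inj₂ (l ∷ pre , l′ , cong (l ∷_) ls≡ , step o e w′ , o″ , tl′≡b)

    last-arc-target : ∀ {a b ls l} → ArcWalk ok a b ls → IsLast l ls → tgt l ≡ b
    last-arc-target w (pre , refl) = go pre w
      where
      go : ∀ {a b l} pre → ArcWalk ok a b (pre ++ l ∷ []) → tgt l ≡ b
      go []        (step _ _ here) = refl
      go (_ ∷ pre) (step _ _ w)     = go pre w

    walk-last-arc : ∀ {a b ls} → ArcWalk ok a b ls → a ≢ b → ∃ λ f → IsLast f ls × tgt f ≡ b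
    walk-last-arc w a≢b with walk-unsnoc w
    ... | inj₁ (_ , a≡b) = ⊥-elim (a≢b a≡b)
    ... | inj₂ (pre , l , ls≡ , _ , _ , tl≡b) = l , (pre , ls≡) , tl≡b

    arc-into-end-is-last : ∀ {a b ls l} → ArcWalk ok a b ls → All (λ l → src l ≢ b) ls →
      l ∈ₗ ls → tgt l ≡ b → IsLast l ls
    arc-into-end-is-last (step _ _ here)              _               (here refl) _ = [] , refl
    arc-into-end-is-last (step _ _ (step _ sl′≡ _)) (_ ∷ sl′≢b ∷ _) (here refl) tl≡b =
      ⊥-elim (sl′≢b (trans sl′≡ tl≡b))
    arc-into-end-is-last (step {l = l′} _ _ w)        (_ ∷ s≢b)      (there l∈)  tl≡b
      with arc-into-end-is-last w s≢b l∈ tl≡b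
    ... | pre , ls≡ = l′ ∷ pre , cong (l′ ∷_) ls≡

    path-arcs-unique : ∀ {a b ls} → ArcPath ok a b ls → Unique ls
    path-arcs-unique (here , _) = []
    path-arcs-unique (step _ sl≡a w , a∉ ∷ u) =
      ¬Any⇒All¬ _ (λ l∈ → All.lookup a∉ (source∈vertices w l∈) (sym sl≡a)) ∷ path-arcs-unique (w , u)

    path-sources≢end : ∀ {a b ls} → ArcPath ok a b ls → All (λ l → src l ≢ b) ls
    path-sources≢end (here , _) = []
    path-sources≢end (step _ sl≡a w , a∉ ∷ u) =
      (λ sl≡b → All.lookup a∉ (target∈vertices w) (trans (sym sl≡a) sl≡b)) ∷ path-sources≢end (w , u)

    suffix-from : ∀ {x a b ls} → ArcPath ok x b ls → a ∈ₗ vertices x ls →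
      ∃ λ suf → ArcPath ok a b suf × suf ⊆ₗ ls
    suffix-from (here , u)          (here refl) = [] , (here , u) , id
    suffix-from (here , _)          (there ())
    suffix-from (step o e w , u)     (here refl) = _ , (step o e w , u) , id
    suffix-from (step _ _ w , _ ∷ u) (there a∈) with suffix-from (w , u) a∈
    ... | suf , p , suf⊆ = suf , p , there ∘ suf⊆

    -- Erase loops from the tail first; if the start vertex recurs on the result, resume from there.
    walk⇒path : ∀ {a b ls} → ArcWalk ok a b ls → ∃ λ ls′ → ArcPath ok a b ls′ × ls′ ⊆ₗ ls
    walk⇒path here = [] , (here , [] ∷ []) , id
    walk⇒path {a} (step {l = l} o e w) with walk⇒path w
    ... | ls′ , (w′ , u′) , ls′⊆ with a ∈ₗ? vertices (tgt l) ls′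
    ...   | yes a∈ with suffix-from (w′ , u′) a∈
    ...     | suf , p , suf⊆ = suf , p , there ∘ ls′⊆ ∘ suf⊆
    walk⇒path {a} (step {l = l} o e w) | ls′ , (w′ , u′) , ls′⊆ | no a∉ =
      l ∷ ls′ , (step o e w′ , ¬Any⇒All¬ _ a∉ ∷ u′) , λ { (here refl) → here refl ; (there l∈) → there (ls′⊆ l∈) }

    -- The last arc of p enters b, and no arc of q leaves b, so it is also the last arc of q.
    path-keeps-last-arc : ∀ {a b q p l} → a ≢ b → ArcWalk ok a b q → All (λ l → src l ≢ b) q →
      ArcWalk ok a b p → p ⊆ₗ q → IsLast l q → IsLast l p
    path-keeps-last-arc a≢b wq q-src≢b wp p⊆q l-last with walk-last-arc wp a≢b
    ... | f , f-last , tf≡b with IsLast-unique (arc-into-end-is-last wq q-src≢b (p⊆q (IsLast⇒∈ f-last)) tf≡b) l-last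
    ...   | refl = f-last

    walks⇒paths : ∀ {a b} → a ≢ b → ∀ qs → All (ArcWalk ok a b) qs → AllPairs Disjoint qs →
      All (λ l → src l ≢ b) (concat qs) →
      ∃ λ ps → All (ArcPath ok a b) ps × AllPairs Disjoint ps × length ps ≡ length qs ×
        (∀ {l} → Any (IsLast l) qs → Any (IsLast l) ps) × concat ps ⊆ₗ concat qs
    walks⇒paths a≢b [] [] [] _ = [] , [] , [] , refl , (λ ()) , id
    walks⇒paths a≢b (q ∷ qs) (wq ∷ wqs) (q#qs ∷ qs#) src≢b
      with walk⇒path wq | walks⇒paths a≢b qs wqs qs# (anti-mono (∈-++⁺ʳ q) src≢b)
    ... | p , (wp , p!) , p⊆q | ps , paths , ps# , len , lasts , ps⊆qs =
      p ∷ ps , (wp , p!) ∷ paths , All.tabulate p#ps ∷ ps# , cong suc len , lasts′ , ⊆qs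
      where
      p#ps : ∀ {p′} → p′ ∈ₗ ps → Disjoint p p′
      p#ps p′∈ (v∈p , v∈p′) with ∈-concat⁻′ qs (ps⊆qs (∈-concat⁺′ v∈p′ p′∈))
      ... | q′ , v∈q′ , q′∈ = All.lookup q#qs q′∈ (p⊆q v∈p , v∈q′)
      lasts′ : ∀ {l} → Any (IsLast l) (q ∷ qs) → Any (IsLast l) (p ∷ ps)
      lasts′ (here l-last) = here (path-keeps-last-arc a≢b wq (anti-mono ∈-++⁺ˡ src≢b) wp p⊆q l-last)
      lasts′ (there l-last) = there (lasts l-last)
      ⊆qs : concat (p ∷ ps) ⊆ₗ concat (q ∷ qs)
      ⊆qs v∈ with ∈-++⁻ p v∈
      ... | inj₁ v∈p  = ∈-++⁺ˡ (p⊆q v∈p)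
      ... | inj₂ v∈ps = ∈-++⁺ʳ q (ps⊆qs v∈ps)

  walk-stays : ∀ {ok} (Z : Fin n → Bool) → (∀ l → ok l → Z (src l) ≡ true → Z (tgt l) ≡ true) →
    ∀ {a b ls} → ArcWalk ok a b ls → Z a ≡ true → Z b ≡ true
  walk-stays Z closed here Za = Za
  walk-stays Z closed (step {l = l} o refl w) Za = walk-stays Z closed w (closed l o Za)

  walk-map : ∀ {ok ok′ : L → Set} → (∀ {l} → ok l → ok′ l) → ∀ {a b ls} → ArcWalk ok a b ls → ArcWalk ok′ a b ls
  walk-map f here          = here
  walk-map f (step o e w) = step (f o) e (walk-map f w)

  inDeg outDeg : List L → Fin n → ℕ
  inDeg  ls y = count (λ l → tgt l == y) ls
  outDeg ls y = count (λ l → src l == y) ls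

  Conserves : List L → (Fin n → ℕ) → (Fin n → ℕ) → Set
  Conserves ls s t = ∀ y → inDeg ls y + s y ≡ outDeg ls y + t y

  conserves-++ : ∀ {xs ys} {s s′ t t′ : Fin n → ℕ} → Conserves xs s t → Conserves ys s′ t′ →
    Conserves (xs ++ ys) (λ y → s y + s′ y) (λ y → t y + t′ y)
  conserves-++ {xs} {ys} {s} {s′} {t} {t′} xs-c ys-c y = begin
    inDeg (xs ++ ys) y + (s y + s′ y)             ≡⟨ cong (_+ (s y + s′ y)) (count-++ _ xs ys) ⟩
    (inDeg xs y + inDeg ys y) + (s y + s′ y)      ≡⟨ interchange (inDeg xs y) _ _ _ ⟩
    (inDeg xs y + s y) + (inDeg ys y + s′ y)      ≡⟨ cong₂ _+_ (xs-c y) (ys-c y) ⟩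
    (outDeg xs y + t y) + (outDeg ys y + t′ y)    ≡⟨ interchange (outDeg xs y) _ _ _ ⟩
    (outDeg xs y + outDeg ys y) + (t y + t′ y)    ≡⟨ cong (_+ (t y + t′ y)) (count-++ _ xs ys) ⟨
    outDeg (xs ++ ys) y + (t y + t′ y)            ∎
    where open ≡-Reasoning

  conserves-cancel : ∀ {ls} (d s t : Fin n → ℕ) →
    Conserves ls (λ y → d y + s y) (λ y → d y + t y) → Conserves ls s t
  conserves-cancel {ls} d s t cons y = +-cancelˡ-≡ (d y) _ _ (begin
    d y + (inDeg ls y + s y)      ≡⟨ x∙yz≈y∙xz (d y) (inDeg ls y) (s y) ⟩
    inDeg ls y + (d y + s y)      ≡⟨ cons y ⟩
    outDeg ls y + (d y + t y)     ≡⟨ x∙yz≈y∙xz (outDeg ls y) (d y) (t y) ⟩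
    d y + (outDeg ls y + t y)     ∎)
    where open ≡-Reasoning

  conserves-skip : ∀ xs {l} ys (s : Fin n → ℕ) {t} → Conserves (xs ++ l ∷ ys) (λ y → δ (src l) y + s y) t →
    Conserves (xs ++ ys) (λ y → δ (tgt l) y + s y) t
  conserves-skip xs {l} ys s {t} cons y = +-cancelˡ-≡ (δ (src l) y) _ _ (begin
    δ (src l) y + (inDeg (xs ++ ys) y + (δ (tgt l) y + s y))    ≡⟨ rearrange (δ (src l) y) (inDeg (xs ++ ys) y) (δ (tgt l) y) (s y) ⟩
    (δ (tgt l) y + inDeg (xs ++ ys) y) + (δ (src l) y + s y)    ≡⟨ cong (_+ (δ (src l) y + s y)) (count-skip _ xs ys) ⟨
    inDeg (xs ++ l ∷ ys) y + (δ (src l) y + s y)                ≡⟨ cons y ⟩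
    outDeg (xs ++ l ∷ ys) y + t y                                ≡⟨ cong (_+ t y) (count-skip _ xs ys) ⟩
    (δ (src l) y + outDeg (xs ++ ys) y) + t y                    ≡⟨ +-assoc (δ (src l) y) (outDeg (xs ++ ys) y) (t y) ⟩
    δ (src l) y + (outDeg (xs ++ ys) y + t y)                    ∎)
    where
    open ≡-Reasoning
    rearrange : ∀ a b c d → a + (b + (c + d)) ≡ (c + b) + (a + d)
    rearrange = solve-∀

  conserves⇒outDeg>0 : ∀ {ls} (s t : Fin n → ℕ) x → Conserves ls s t → 0 < s x → t x ≡ 0 → 0 < outDeg ls x
  conserves⇒outDeg>0 {ls} s t x cons s>0 t≡0 = begin-strict
    0                        <⟨ s>0 ⟩
    s x                      ≤⟨ m≤n+m (s x) (inDeg ls x) ⟩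
    inDeg ls x + s x         ≡⟨ cons x ⟩
    outDeg ls x + t x        ≡⟨ cong (outDeg ls x +_) t≡0 ⟩
    outDeg ls x + 0          ≡⟨ +-identityʳ _ ⟩
    outDeg ls x              ∎
    where open ≤-Reasoning

  walk-conserves : ∀ {ok a b ls} → ArcWalk ok a b ls → Conserves ls (δ a) (δ b)
  walk-conserves here y = refl
  walk-conserves {b = b} (step {l = l} {ls = ls} _ refl w) y = begin
    (δ (tgt l) y + inDeg ls y) + δ (src l) y     ≡⟨ xy∙z≈z∙yx (δ (tgt l) y) _ _ ⟩
    δ (src l) y + (inDeg ls y + δ (tgt l) y)     ≡⟨ cong (δ (src l) y +_) (walk-conserves w y) ⟩
    δ (src l) y + (outDeg ls y + δ b y)          ≡⟨ +-assoc (δ (src l) y) _ _ ⟨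
    (δ (src l) y + outDeg ls y) + δ b y          ∎
    where open ≡-Reasoning

  walks-conserve : ∀ {ok a b ps} → All (ArcWalk ok a b) ps →
    Conserves (concat ps) (λ y → length ps * δ a y) (λ y → length ps * δ b y)
  walks-conserve []       y = refl
  walks-conserve {ps = p ∷ ps} (w ∷ ws) = conserves-++ {xs = p} {ys = concat ps} (walk-conserves w) (walks-conserve ws)

  leaves enters : (Fin n → Bool) → L → Bool
  leaves X l = X (src l) ∧ not (X (tgt l))
  enters X l = not (X (src l)) ∧ X (tgt l)

  walk-crossings : ∀ (X : Fin n → Bool) {ok a b ls} → ArcWalk ok a b ls →
    count (leaves X) ls + 𝟙 (X b) ≡ count (enters X) ls + 𝟙 (X a)
  walk-crossings X here = refl
  walk-crossings X (step {l = l} {ls = ls} _ refl w) with X (src l) | X (tgt l) | walk-crossings X w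
  ... | true  | true  | ih = ih
  ... | false | false | ih = ih
  ... | true  | false | ih = trans (cong suc ih) (trans (cong suc (+-identityʳ _)) (+-comm 1 (count (enters X) ls)))
  ... | false | true  | ih = trans ih (trans (+-comm _ 1) (cong suc (sym (+-identityʳ _))))

  walks-crossings : ∀ (X : Fin n → Bool) {ok a b ps} → X a ≡ true → X b ≡ false → All (ArcWalk ok a b) ps →
    count (leaves X) (concat ps) ≡ length ps + count (enters X) (concat ps)
  walks-crossings X Xa Xb [] = refl
  walks-crossings X {a = a} {b} Xa Xb (_∷_ {x = p} {xs = ps} w ws) = begin
    count (leaves X) (p ++ concat ps)                                ≡⟨ count-++ _ p (concat ps) ⟩
    count (leaves X) p + count (leaves X) (concat ps)                ≡⟨ cong₂ _+_ one-crossing (walks-crossings X Xa Xb ws) ⟩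
    suc (count (enters X) p) + (length ps + count (enters X) (concat ps))
      ≡⟨ cong suc (x∙yz≈y∙xz (count (enters X) p) (length ps) _) ⟩
    suc (length ps + (count (enters X) p + count (enters X) (concat ps)))
      ≡⟨ cong (suc (length ps) +_) (count-++ _ p (concat ps)) ⟨
    suc (length ps) + count (enters X) (p ++ concat ps)              ∎
    where
    open ≡-Reasoning
    one-crossing : count (leaves X) p ≡ suc (count (enters X) p)
    one-crossing = begin
      count (leaves X) p                  ≡⟨ +-identityʳ _ ⟨
      count (leaves X) p + 𝟙 false        ≡⟨ cong (λ x → count (leaves X) p + 𝟙 x) Xb ⟨
      count (leaves X) p + 𝟙 (X b)        ≡⟨ walk-crossings X w ⟩
      count (enters X) p + 𝟙 (X a)        ≡⟨ cong (λ x → count (enters X) p + 𝟙 x) Xa ⟩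
      count (enters X) p + 1              ≡⟨ +-comm _ 1 ⟩
      suc (count (enters X) p)            ∎

module Reachability {n : ℕ} {L : Set} (src tgt : L → Fin n) (ok : L → Set) (ok? : Decidable ok)
                    (arcs : List L) (arcs-complete : ∀ l → l ∈ₗ arcs) (a : Fin n) where
  open Arcs src tgt

  abstract
    reachable-within : ℕ → Fin n → Bool
    reachable-within zero    y = a == y
    reachable-within (suc i) y =
      reachable-within i y ∨ any (λ l → reachable-within i (src l) ∧ does (ok? l) ∧ (tgt l == y)) arcs

    reachable-within-start : ∀ i → reachable-within i a ≡ true
    reachable-within-start zero = dec-true (a ≟ a) refl
    reachable-within-start (suc i) rewrite reachable-within-start i = refl

    reachable-within-sound : ∀ i y → reachable-within i y ≡ true → ∃ λ ls → ArcWalk ok a y ls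
    reachable-within-sound zero y a==y = [] , subst (λ v → ArcWalk ok a v []) (does⇒ (a ≟ y) a==y) here
    reachable-within-sound (suc i) y h with ∨-true⁻ {reachable-within i y} h
    ... | inj₁ h′ = reachable-within-sound i y h′
    ... | inj₂ h′ with any-true⁻ _ arcs h′
    ...   | l , _ , pl with ∧-true⁻ pl
    ...     | src-reached , rest with ∧-true⁻ rest
    ...       | valid , tl==y with reachable-within-sound i (src l) src-reached
    ...         | ls , w = ls ++ l ∷ [] ,
      subst (λ v → ArcWalk ok a v (ls ++ l ∷ [])) (does⇒ (tgt l ≟ y) tl==y) (walk-snoc w (does⇒ (ok? l) valid) refl)

    reachable-within-complete : ∀ i {y ls} → ArcWalk ok a y ls → length ls ≤ i → reachable-within i y ≡ true
    reachable-within-complete i w len≤i with walk-unsnoc w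
    ... | inj₁ (refl , refl) = reachable-within-start i
    reachable-within-complete zero w len≤i | inj₂ (pre , l , refl , _ , _ , _)
      with () ← subst (_≤ 0) (length-++-∷ʳ pre) len≤i
    reachable-within-complete (suc i) {y} w len≤i | inj₂ (pre , l , refl , w′ , valid , tl≡y)
      with reachable-within i y
    ... | true  = refl
    ... | false = any-true⁺ _ arcs (arcs-complete l)
      (∧-true⁺ (reachable-within-complete i w′ (≤-pred (subst (_≤ suc i) (length-++-∷ʳ pre) len≤i)))
               (∧-true⁺ (dec-true (ok? l) valid) (dec-true (tgt l ≟ y) tl≡y)))

  reachable : Fin n → Bool
  reachable = reachable-within n

  reachable-start : reachable a ≡ true
  reachable-start = reachable-within-start n

  reachable⇒walk : ∀ y → reachable y ≡ true → ∃ λ ls → ArcWalk ok a y ls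
  reachable⇒walk = reachable-within-sound n

  reachable-least : ∀ (Z : Fin n → Bool) → Z a ≡ true → (∀ l → ok l → Z (src l) ≡ true → Z (tgt l) ≡ true) →
    ∀ y → reachable y ≡ true → Z y ≡ true
  reachable-least Z Za closed y reached = walk-stays Z closed (proj₂ (reachable⇒walk y reached)) Za

  -- n rounds suffice: loop erasure shortens the walk to tgt l to fewer than n arcs.
  reachable-closed : ∀ l → ok l → reachable (src l) ≡ true → reachable (tgt l) ≡ true
  reachable-closed l valid reached with reachable⇒walk (src l) reached
  ... | ls , w with walk⇒path (walk-snoc w valid refl)
  ...   | ls′ , (w′ , vs!) , _ = reachable-within-complete n w′ (begin
    length ls′                   ≤⟨ n≤1+n _ ⟩
    suc (length ls′)             ≡⟨ length-vertices a ls′ ⟨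
    length (vertices a ls′)      ≤⟨ length-mono-unique (vertices a ls′) vs! (λ {v} _ → ∈-allFin v) ⟩
    length (allFin n)            ≡⟨ length-tabulate {n = n} id ⟩
    n                            ∎)
    where open ≤-Reasoning

module FlowDecomposition {n : ℕ} {L : Set} (src tgt : L → Fin n) (ok : L → Set) (r w : Fin n) where
  open Arcs src tgt

  record Peeling (c : ℕ) (x : Fin n) (R : List L) : Set where
    constructor peeling
    field
      walk rest      : List L
      walk-x⇝w       : ArcWalk ok x w walk
      covered        : R ⊆ₗ walk ++ rest
      taken          : walk ++ rest ⊆ₗ R
      walk#rest      : Disjoint walk rest
      rest!          : Unique rest
      rest-conserves : Conserves rest (λ y → c * δ r y) (λ y → c * δ w y)

  -- Follow unused arcs out of x until w is reached; conservation guarantees an exit everywhere else.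
  peel : ∀ c fuel R → length R ≤ fuel → ∀ x → Unique R → All ok R → All (λ l → src l ≢ w) R →
    Conserves R (λ y → δ x y + c * δ r y) (λ y → suc c * δ w y) → Peeling c x R
  peel c fuel R _ x R! _ _ cons with x ≟ w
  ... | yes refl = peeling [] R here id id (λ ()) R! (conserves-cancel {R} (δ w) (λ y → c * δ r y) (λ y → c * δ w y) cons)
  ... | no x≢w with count>0⇒true (λ l → src l == x) R
                      (conserves⇒outDeg>0 {R} (λ y → δ x y + c * δ r y) (λ y → suc c * δ w y) x cons supply>0 no-demand)
    where
    supply>0 : 0 < δ x x + c * δ r x
    supply>0 rewrite dec-true (x ≟ x) refl = s≤s z≤n
    no-demand : suc c * δ w x ≡ 0
    no-demand rewrite dec-false (w ≟ x) (x≢w ∘ sym) = *-zeroʳ (suc c)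
  peel c zero R len x R! ok-R src≢w cons | no _ | l , l∈R , _ with () ← ≤-trans (∈⇒length>0 l∈R) len
  peel c (suc fuel) R len x R! ok-R src≢w cons | no _ | l , l∈R , src==x
    with does⇒ (src l ≟ x) src==x | ∈-∃++ l∈R
  ... | refl | R₁ , R₂ , refl with unique-skip R₁ R!
  ...   | R₁₂! , l∉R₁₂
    with peel c fuel (R₁ ++ R₂) (≤-pred (subst (_≤ suc fuel) (length-++-sucʳ R₁ l R₂) len)) (tgt l) R₁₂!
           (anti-mono (∈-skip⁺ R₁) ok-R) (anti-mono (∈-skip⁺ R₁) src≢w) (conserves-skip R₁ R₂ (λ y → c * δ r y) cons)
  ... | peeling ws R′ w⇝ cov tak ws#R′ R′! cons′ =
    peeling (l ∷ ws) R′ (step (All.lookup ok-R l∈R) refl w⇝) cov′ tak′ l∷ws#R′ R′! cons′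
    where
    cov′ : R₁ ++ l ∷ R₂ ⊆ₗ (l ∷ ws) ++ R′
    cov′ z∈ with ∈-skip⁻ R₁ z∈
    ... | inj₁ refl = here refl
    ... | inj₂ z∈R₁₂ = there (cov z∈R₁₂)
    tak′ : (l ∷ ws) ++ R′ ⊆ₗ R₁ ++ l ∷ R₂
    tak′ (here refl) = ∈-++⁺ʳ R₁ (here refl)
    tak′ (there z∈)  = ∈-skip⁺ R₁ (tak z∈)
    l∷ws#R′ : Disjoint (l ∷ ws) R′
    l∷ws#R′ (here refl , l∈R′) = l∉R₁₂ (tak (∈-++⁺ʳ ws l∈R′))
    l∷ws#R′ (there z∈ws , z∈R′) = ws#R′ (z∈ws , z∈R′)

  record Decomposition (c : ℕ) (F : List L) : Set where
    constructor decomposition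
    field
      walks        : List (List L)
      length-walks : length walks ≡ c
      all-walks    : All (ArcWalk ok r w) walks
      pairwise#    : AllPairs Disjoint walks
      walks⊆F      : concat walks ⊆ₗ F
      last-arcs    : ∀ {l} → l ∈ₗ F → tgt l ≡ w → Any (IsLast l) walks

  decompose : ∀ c F → Unique F → All ok F → All (λ l → src l ≢ w) F →
    Conserves F (λ y → c * δ r y) (λ y → c * δ w y) → Decomposition c F
  decompose zero F _ _ src≢w cons = decomposition [] refl [] [] (λ ()) nothing-enters-w
    where
    in-w≡0 : inDeg F w ≡ 0
    in-w≡0 = begin
      inDeg F w           ≡⟨ +-identityʳ _ ⟨
      inDeg F w + 0       ≡⟨ cons w ⟩
      outDeg F w + 0      ≡⟨ +-identityʳ _ ⟩
      outDeg F w          ≡⟨ count-none (All.map (λ {l} → dec-false (src l ≟ w)) src≢w) ⟩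
      0                   ∎
      where open ≡-Reasoning
    nothing-enters-w : ∀ {l} → l ∈ₗ F → tgt l ≡ w → Any (IsLast l) []
    nothing-enters-w {l} l∈F tl≡w =
      ⊥-elim (does⇒¬ (tgt l ≟ w) (count≡0⇒false (λ l → tgt l == w) F in-w≡0 l∈F) tl≡w)
  decompose (suc c) F F! ok-F src≢w cons with peel c (length F) F ≤-refl r F! ok-F src≢w cons
  ... | peeling ws R ws-walk cov tak ws#R R! cons′
    with decompose c R R! (anti-mono (tak ∘ ∈-++⁺ʳ ws) ok-F) (anti-mono (tak ∘ ∈-++⁺ʳ ws) src≢w) cons′
  ... | decomposition wss len wss-walks pair# wss⊆R lasts =
    decomposition (ws ∷ wss) (cong suc len) (ws-walk ∷ wss-walks) (All.tabulate ws#wss ∷ pair#) ⊆F lasts′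
    where
    ws#wss : ∀ {p} → p ∈ₗ wss → Disjoint ws p
    ws#wss p∈ (v∈ws , v∈p) = ws#R (v∈ws , wss⊆R (∈-concat⁺′ v∈p p∈))
    ⊆F : concat (ws ∷ wss) ⊆ₗ F
    ⊆F z∈ with ∈-++⁻ ws z∈
    ... | inj₁ z∈ws  = tak (∈-++⁺ˡ z∈ws)
    ... | inj₂ z∈wss = tak (∈-++⁺ʳ ws (wss⊆R z∈wss))
    lasts′ : ∀ {l} → l ∈ₗ F → tgt l ≡ w → Any (IsLast l) (ws ∷ wss)
    lasts′ l∈F tl≡w with ∈-++⁻ ws (cov l∈F)
    ... | inj₁ l∈ws = here (arc-into-end-is-last ws-walk (anti-mono (tak ∘ ∈-++⁺ˡ) src≢w) l∈ws tl≡w)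
    ... | inj₂ l∈R  = there (lasts l∈R tl≡w)

-- Submodularity of the cut function, edge by edge; checked on all sixteen cases.
leaves-submodular : ∀ xt xh yt yh →
  𝟙 ((xt ∧ yt) ∧ not (xh ∧ yh)) + 𝟙 ((xt ∨ yt) ∧ not (xh ∨ yh)) ≤ 𝟙 (xt ∧ not xh) + 𝟙 (yt ∧ not yh)
leaves-submodular xt xh yt yh = ≤ᵇ⇒≤ _ _ (table xt xh yt yh)
  where
  table : ∀ xt xh yt yh →
    T (𝟙 ((xt ∧ yt) ∧ not (xh ∧ yh)) + 𝟙 ((xt ∨ yt) ∧ not (xh ∨ yh)) ≤ᵇ 𝟙 (xt ∧ not xh) + 𝟙 (yt ∧ not yh))
  table true  true  true  true  = _
  table true  true  true  false = _
  table true  true  false true  = _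
  table true  true  false false = _
  table true  false true  true  = _
  table true  false true  false = _
  table true  false false true  = _
  table true  false false false = _
  table false true  true  true  = _
  table false true  true  false = _
  table false true  false true  = _
  table false true  false false = _
  table false false true  true  = _
  table false false true  false = _
  table false false false true  = _
  table false false false false = _

module Digraphs {n : ℕ} (U : EdgeUniverse n) where
  open EdgeUniverse U
  open Arcs tl hd
  open import Data.List.Membership.DecPropositional (_≟_ {m})
    using () renaming (_∈?_ to _∈ₗ?_; _∉?_ to _∉ₗ?_)

  walk⇒arcWalk : ∀ {G a b es} → Walk U G a b es → ArcWalk (_∈ G) a b es
  walk⇒arcWalk here            = here
  walk⇒arcWalk (step g∈ e w) = step g∈ e (walk⇒arcWalk w)

  arcWalk⇒walk : ∀ {G a b es} → ArcWalk (_∈ G) a b es → Walk U G a b es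
  arcWalk⇒walk here            = here
  arcWalk⇒walk (step g∈ e w) = step g∈ e (arcWalk⇒walk w)

  verts≡vertices : ∀ a es → verts U a es ≡ vertices a es
  verts≡vertices a []       = refl
  verts≡vertices a (e ∷ es) = cong (a ∷_) (verts≡vertices (hd e) es)

  path⇒arcPath : ∀ {G a b es} → Path U G a b es → ArcPath (_∈ G) a b es
  path⇒arcPath {es = es} (w , u) = walk⇒arcWalk w , subst Unique (verts≡vertices _ es) u

  arcPath⇒path : ∀ {G a b es} → ArcPath (_∈ G) a b es → Path U G a b es
  arcPath⇒path {es = es} (w , u) = arcWalk⇒walk w , subst Unique (sym (verts≡vertices _ es)) u

  system-mono : ∀ {G G′ r w ps} → (∀ {g} → g ∈ G → g ∈ G′) → DisjointPaths U G r w ps → DisjointPaths U G′ r w ps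
  system-mono G⊆G′ (paths , pairwise#) =
    All.map (λ p → arcPath⇒path (Data.Product.map₁ (walk-map G⊆G′) (path⇒arcPath p))) paths , pairwise#

  module PathSystem {G : Subset m} {r w : Fin n} {ps : List (List (Edge U))} (sys : DisjointPaths U G r w ps) where

    edges : List (Edge U)
    edges = concat ps

    arcPaths : All (ArcPath (_∈ G) r w) ps
    arcPaths = All.map path⇒arcPath (proj₁ sys)

    walks : All (ArcWalk (_∈ G) r w) ps
    walks = All.map proj₁ arcPaths

    edges! : Unique edges
    edges! = Unique.concat⁺ (All.map path-arcs-unique arcPaths) (proj₂ sys)

    edges⊆G : All (_∈ G) edges
    edges⊆G = All.concat⁺ (All.map (walk-ok ∘ proj₁) arcPaths)

    edges-tl≢w : All (λ g → tl g ≢ w) edges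
    edges-tl≢w = All.concat⁺ (All.map path-sources≢end arcPaths)

    edges-conserve : Conserves edges (λ y → length ps * δ r y) (λ y → length ps * δ w y)
    edges-conserve = walks-conserve walks

    ∈-edges : ∀ {g p} → p ∈ₗ ps → IsLast g p → g ∈ₗ edges × hd g ≡ w
    ∈-edges p∈ g-last = ∈-concat⁺′ (IsLast⇒∈ g-last) p∈ , last-arc-target (All.lookup walks p∈) g-last

    length≤m : r ≢ w → length ps ≤ m
    length≤m r≢w = begin
      length ps                  ≤⟨ length≤edges ps walks ⟩
      length edges               ≤⟨ length-mono-unique edges edges! (λ {g} _ → ∈-allFin g) ⟩
      length (allFin m)          ≡⟨ length-tabulate {n = m} id ⟩
      m                          ∎
      where
      open ≤-Reasoning
      length≤edges : ∀ qs → All (ArcWalk (_∈ G) r w) qs → length qs ≤ length (concat qs)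
      length≤edges [] [] = z≤n
      length≤edges (q ∷ qs) (here ∷ _) = ⊥-elim (r≢w refl)
      length≤edges (q@(_ ∷ q′) ∷ qs) (step _ _ _ ∷ wqs) =
        subst (suc (length qs) ≤_) (sym (length-++ q)) (s≤s (≤-trans (length≤edges qs wqs) (m≤n+m _ (length q′))))

  cut-size : Subset m → (Fin n → Bool) → ℕ
  cut-size G X = count (λ g → does (g ∈? G) ∧ leaves X g) (allFin m)

  crossings≤cut-size : ∀ {G} X F → Unique F → All (_∈ G) F → count (leaves X) F ≤ cut-size G X
  crossings≤cut-size {G} X F F! F⊆G =
    count-mono-unique F F! (λ {g} g∈F lv → ∈-allFin g , ∧-true⁺ (dec-true (g ∈? G) (All.lookup F⊆G g∈F)) lv)

  cut-submodular : ∀ G X Y →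
    cut-size G (λ x → X x ∧ Y x) + cut-size G (λ x → X x ∨ Y x) ≤ cut-size G X + cut-size G Y
  cut-submodular G X Y = count-mono₂ _ _ _ _ (allFin m) pointwise
    where
    inG∧ : (Fin n → Bool) → Fin m → Bool
    inG∧ Z g = does (g ∈? G) ∧ leaves Z g
    pointwise : ∀ g →
      𝟙 (inG∧ (λ x → X x ∧ Y x) g) + 𝟙 (inG∧ (λ x → X x ∨ Y x) g) ≤ 𝟙 (inG∧ X g) + 𝟙 (inG∧ Y g)
    pointwise g with does (g ∈? G)
    ... | true  = leaves-submodular (X (tl g)) (X (hd g)) (Y (tl g)) (Y (hd g))
    ... | false = z≤n

  module _ {G : Subset m} {r w : Fin n} {ps : List (List (Edge U))} (sys : DisjointPaths U G r w ps) where
    open PathSystem sys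

    paths+entering≤cut-size : ∀ X → X r ≡ true → X w ≡ false →
      length ps + count (enters X) edges ≤ cut-size G X
    paths+entering≤cut-size X Xr Xw =
      subst (_≤ cut-size G X) (walks-crossings X Xr Xw walks) (crossings≤cut-size X edges edges! edges⊆G)

    tight-cut : ∀ X → X r ≡ true → X w ≡ false → cut-size G X ≤ length ps →
      (∀ {g} → g ∈ₗ edges → enters X g ≡ false) × (∀ {g} → g ∈ G → leaves X g ≡ true → g ∈ₗ edges)
    tight-cut X Xr Xw tight = count≡0⇒false (enters X) edges no-entering , all-used
      where
      bound : length ps + count (enters X) edges ≤ length ps
      bound = ≤-trans (paths+entering≤cut-size X Xr Xw) tight
      no-entering : count (enters X) edges ≡ 0
      no-entering = n≤0⇒n≡0 (+-cancelˡ-≤ (length ps) _ 0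
        (subst (length ps + count (enters X) edges ≤_) (sym (+-identityʳ (length ps))) bound))
      all-used : ∀ {g} → g ∈ G → leaves X g ≡ true → g ∈ₗ edges
      all-used {g} g∈G lv with g ∈ₗ? edges
      ... | yes g∈ = g∈
      ... | no g∉ = ⊥-elim (1+n≰n (begin
        suc (length ps)                            ≤⟨ s≤s (m≤m+n _ _) ⟩
        suc (length ps + count (enters X) edges)   ≡⟨ cong suc (walks-crossings X Xr Xw walks) ⟨
        suc (count (leaves X) edges)               ≡⟨ cong (_+ count (leaves X) edges) (cong 𝟙 lv) ⟨
        count (leaves X) (g ∷ edges)
          ≤⟨ crossings≤cut-size X (g ∷ edges) (¬Any⇒All¬ _ g∉ ∷ edges!) (g∈G ∷ edges⊆G) ⟩
        cut-size G X                               ≤⟨ tight ⟩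
        length ps                                  ∎))
        where open ≤-Reasoning

  data ResArc : Set where
    forward backward : Edge U → ResArc

  rsrc rtgt : ResArc → Fin n
  rsrc (forward g)  = tl g
  rsrc (backward g) = hd g
  rtgt (forward g)  = hd g
  rtgt (backward g) = tl g

  module Res = Arcs rsrc rtgt

  residual-arcs : List ResArc
  residual-arcs = map forward (allFin m) ++ map backward (allFin m)

  residual-arcs-complete : ∀ a → a ∈ₗ residual-arcs
  residual-arcs-complete (forward g)  = ∈-++⁺ˡ (∈-map⁺ forward (∈-allFin g))
  residual-arcs-complete (backward g) = ∈-++⁺ʳ _ (∈-map⁺ backward (∈-allFin g))

  forwards backwards : List ResArc → List (Edge U)
  forwards []                = []
  forwards (forward g ∷ as)  = g ∷ forwards as
  forwards (backward _ ∷ as) = forwards as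
  backwards []                = []
  backwards (forward _ ∷ as)  = backwards as
  backwards (backward g ∷ as) = g ∷ backwards as

  ∈-forwards⁻ : ∀ as {g} → g ∈ₗ forwards as → forward g ∈ₗ as
  ∈-forwards⁻ (forward _ ∷ as)  (here refl) = here refl
  ∈-forwards⁻ (forward _ ∷ as)  (there g∈)  = there (∈-forwards⁻ as g∈)
  ∈-forwards⁻ (backward _ ∷ as) g∈          = there (∈-forwards⁻ as g∈)

  ∈-forwards⁺ : ∀ as {g} → forward g ∈ₗ as → g ∈ₗ forwards as
  ∈-forwards⁺ (forward _ ∷ as)  (here refl) = here refl
  ∈-forwards⁺ (forward _ ∷ as)  (there a∈)  = there (∈-forwards⁺ as a∈)
  ∈-forwards⁺ (backward _ ∷ as) (there a∈)  = ∈-forwards⁺ as a∈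

  ∈-backwards⁻ : ∀ as {g} → g ∈ₗ backwards as → backward g ∈ₗ as
  ∈-backwards⁻ (backward _ ∷ as) (here refl) = here refl
  ∈-backwards⁻ (backward _ ∷ as) (there g∈)  = there (∈-backwards⁻ as g∈)
  ∈-backwards⁻ (forward _ ∷ as)  g∈          = there (∈-backwards⁻ as g∈)

  forwards-unique : ∀ as → Unique as → Unique (forwards as)
  forwards-unique [] _ = []
  forwards-unique (forward g ∷ as) (a∉ ∷ as!) =
    All.tabulate (λ g′∈ g≡g′ → All.lookup a∉ (∈-forwards⁻ as g′∈) (cong forward g≡g′))
      ∷ forwards-unique as as!
  forwards-unique (backward _ ∷ as) (_ ∷ as!) = forwards-unique as as!

  backwards-unique : ∀ as → Unique as → Unique (backwards as)
  backwards-unique [] _ = []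
  backwards-unique (backward g ∷ as) (a∉ ∷ as!) =
    All.tabulate (λ g′∈ g≡g′ → All.lookup a∉ (∈-backwards⁻ as g′∈) (cong backward g≡g′))
      ∷ backwards-unique as as!
  backwards-unique (forward _ ∷ as) (_ ∷ as!) = backwards-unique as as!

  residual-inDeg : ∀ as y → Res.inDeg as y ≡ inDeg (forwards as) y + outDeg (backwards as) y
  residual-inDeg [] y = refl
  residual-inDeg (forward g ∷ as) y =
    trans (cong (δ (hd g) y +_) (residual-inDeg as y)) (sym (+-assoc (δ (hd g) y) _ _))
  residual-inDeg (backward g ∷ as) y =
    trans (cong (δ (tl g) y +_) (residual-inDeg as y)) (x∙yz≈y∙xz (δ (tl g) y) (inDeg (forwards as) y) _)

  residual-outDeg : ∀ as y → Res.outDeg as y ≡ outDeg (forwards as) y + inDeg (backwards as) y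
  residual-outDeg [] y = refl
  residual-outDeg (forward g ∷ as) y =
    trans (cong (δ (tl g) y +_) (residual-outDeg as y)) (sym (+-assoc (δ (tl g) y) _ _))
  residual-outDeg (backward g ∷ as) y =
    trans (cong (δ (hd g) y +_) (residual-outDeg as y)) (x∙yz≈y∙xz (δ (hd g) y) (outDeg (forwards as) y) _)

  count-⊆-split : ∀ (p : Edge U → Bool) {xs ys} → Unique xs → Unique ys → ys ⊆ₗ xs →
    count p xs ≡ count p ys + count p (filter (_∉ₗ? ys) xs)
  count-⊆-split p {xs} {ys} xs! ys! ys⊆xs = begin
    count p xs                                                      ≡⟨ count-split (λ g → does (g ∈ₗ? ys)) p xs ⟩
    count (λ g → does (g ∈ₗ? ys) ∧ p g) xs + count (λ g → does (g ∉ₗ? ys) ∧ p g) xs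
                                                                    ≡⟨ cong₂ _+_ in-ys (sym (count-filter (_∉ₗ? ys) p xs)) ⟩
    count p ys + count p (filter (_∉ₗ? ys) xs)                      ∎
    where
    open ≡-Reasoning
    in-ys : count (λ g → does (g ∈ₗ? ys) ∧ p g) xs ≡ count p ys
    in-ys = ≤-antisym
      (count-mono-unique xs xs! (λ {g} _ h → let g∈ys , pg = ∧-true⁻ h in does⇒ (g ∈ₗ? ys) g∈ys , pg))
      (count-mono-unique ys ys! (λ {g} g∈ys pg → ys⊆xs g∈ys , ∧-true⁺ (dec-true (g ∈ₗ? ys) g∈ys) pg))

  module Residual (G : Subset m) (r w : Fin n) (r≢w : r ≢ w)
                  (ps : List (List (Edge U))) (sys : DisjointPaths U G r w ps) where
    open PathSystem sys

    -- Arcs at the sink are left out, so residual walks ending at w never pass through it.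
    Valid : ResArc → Set
    Valid (forward g)  = g ∈ G × g ∉ₗ edges × tl g ≢ w
    Valid (backward g) = g ∈ₗ edges × hd g ≢ w

    valid? : Decidable Valid
    valid? (forward g)  = (g ∈? G) ×-dec (g ∉ₗ? edges) ×-dec ¬? (tl g ≟ w)
    valid? (backward g) = (g ∈ₗ? edges) ×-dec ¬? (hd g ≟ w)

    valid-rsrc≢w : ∀ a → Valid a → rsrc a ≢ w
    valid-rsrc≢w (forward _)  (_ , _ , tl≢w) = tl≢w
    valid-rsrc≢w (backward _) (_ , hd≢w)     = hd≢w

    open Reachability rsrc rtgt Valid valid? residual-arcs residual-arcs-complete r public

    cut-size≤paths : reachable w ≡ false → cut-size G reachable ≤ length ps
    cut-size≤paths w-unreached = begin
      cut-size G reachable                                 ≤⟨ count-mono-unique (allFin m) (Unique.allFin⁺ m) leaving-used ⟩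
      count (leaves reachable) edges                       ≡⟨ walks-crossings reachable reachable-start w-unreached walks ⟩
      length ps + count (enters reachable) edges           ≡⟨ cong (length ps +_) (count-none (All.tabulate none-entering)) ⟩
      length ps + 0                                        ≡⟨ +-identityʳ _ ⟩
      length ps                                            ∎
      where
      open ≤-Reasoning
      ≢w : ∀ {x} → reachable x ≡ true → x ≢ w
      ≢w x-reached refl with () ← trans (sym x-reached) w-unreached
      leaving-used : ∀ {g} → g ∈ₗ allFin m → does (g ∈? G) ∧ leaves reachable g ≡ true →
        g ∈ₗ edges × leaves reachable g ≡ true
      leaving-used {g} _ h with ∧-true⁻ h
      ... | g∈G , lv with ∧-true⁻ lv | g ∈ₗ? edges
      ...   | _ , _ | yes g∈ = g∈ , lv
      ...   | tl-reached , hd-unreached | no g∉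
        with () ← trans (sym (reachable-closed (forward g) (does⇒ (g ∈? G) g∈G , g∉ , ≢w tl-reached) tl-reached))
                        (not-true⁻ hd-unreached)
      none-entering : ∀ {g} → g ∈ₗ edges → enters reachable g ≡ false
      none-entering {g} g∈ with reachable (tl g) in tl-r | reachable (hd g) in hd-r
      ... | true  | _     = refl
      ... | false | false = refl
      ... | false | true  with () ← trans (sym (reachable-closed (backward g) (g∈ , ≢w hd-r) hd-r)) tl-r

    record Augmentation (W : List ResArc) : Set where
      constructor augmentation
      field
        paths         : List (List (Edge U))
        paths-system  : DisjointPaths U G r w paths
        one-more      : length paths ≡ suc (length ps)
        keeps-last    : ∀ {g} → Any (IsLast g) ps ⊎ IsLast (forward g) W → Any (IsLast g) paths

    -- Reroute along W: drop the edges W traverses backwards, add those it traverses forwards,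
    -- and decompose the resulting flow of one more unit.
    module Rerouting {W : List ResArc} (W-path : Res.ArcPath Valid r w W) where

      W-walk : Res.ArcWalk Valid r w W
      W-walk = proj₁ W-path

      W! : Unique W
      W! = Res.path-arcs-unique W-path

      Fw B Rem rerouted : List (Edge U)
      Fw  = forwards W
      B   = backwards W
      Rem = filter (_∉ₗ? B) edges
      rerouted = Rem ++ Fw

      fw-valid : ∀ {g} → g ∈ₗ Fw → g ∈ G × g ∉ₗ edges × tl g ≢ w
      fw-valid g∈ = All.lookup (Res.walk-ok W-walk) (∈-forwards⁻ W g∈)

      b-valid : ∀ {g} → g ∈ₗ B → g ∈ₗ edges × hd g ≢ w
      b-valid g∈ = All.lookup (Res.walk-ok W-walk) (∈-backwards⁻ W g∈)

      ∈-rerouted⁻ : ∀ {g} → g ∈ₗ rerouted → g ∈ₗ edges ⊎ g ∈ₗ Fw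
      ∈-rerouted⁻ g∈ with ∈-++⁻ Rem g∈
      ... | inj₁ g∈Rem = inj₁ (proj₁ (∈-filter⁻ (_∉ₗ? B) g∈Rem))
      ... | inj₂ g∈Fw  = inj₂ g∈Fw

      rerouted! : Unique rerouted
      rerouted! = Unique.++⁺ (Unique.filter⁺ (_∉ₗ? B) edges!) (forwards-unique W W!)
        (λ (g∈Rem , g∈Fw) → proj₁ (proj₂ (fw-valid g∈Fw)) (proj₁ (∈-filter⁻ (_∉ₗ? B) g∈Rem)))

      rerouted⊆G : All (_∈ G) rerouted
      rerouted⊆G = All.tabulate λ g∈ → [ All.lookup edges⊆G , proj₁ ∘ fw-valid ] (∈-rerouted⁻ g∈)

      rerouted-tl≢w : All (λ g → tl g ≢ w) rerouted
      rerouted-tl≢w = All.tabulate λ g∈ → [ All.lookup edges-tl≢w , proj₂ ∘ proj₂ ∘ fw-valid ] (∈-rerouted⁻ g∈)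

      rerouted-conserves : Conserves rerouted (λ y → suc (length ps) * δ r y) (λ y → suc (length ps) * δ w y)
      rerouted-conserves y = begin
        inDeg rerouted y + (δ r y + length ps * δ r y)
          ≡⟨ cong (_+ (δ r y + length ps * δ r y)) (count-++ _ Rem Fw) ⟩
        (inDeg Rem y + inDeg Fw y) + (δ r y + length ps * δ r y)
          ≡⟨ merge-balances (inDeg Rem y) (inDeg Fw y) (inDeg B y) (outDeg Rem y) (outDeg Fw y) (outDeg B y)
               (δ r y) (δ w y) (length ps * δ r y) (length ps * δ w y) edges-balance W-balance ⟩
        (outDeg Rem y + outDeg Fw y) + (δ w y + length ps * δ w y)
          ≡⟨ cong (_+ (δ w y + length ps * δ w y)) (count-++ _ Rem Fw) ⟨
        outDeg rerouted y + (δ w y + length ps * δ w y)    ∎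
        where
        open ≡-Reasoning
        split : ∀ p → count p edges ≡ count p B + count p Rem
        split p = count-⊆-split p edges! (backwards-unique W W!) (proj₁ ∘ b-valid)
        edges-balance : (inDeg B y + inDeg Rem y) + length ps * δ r y ≡ (outDeg B y + outDeg Rem y) + length ps * δ w y
        edges-balance = subst₂ (λ i o → i + length ps * δ r y ≡ o + length ps * δ w y)
          (split _) (split _) (edges-conserve y)
        W-balance : (inDeg Fw y + outDeg B y) + δ r y ≡ (outDeg Fw y + inDeg B y) + δ w y
        W-balance = subst₂ (λ i o → i + δ r y ≡ o + δ w y)
          (residual-inDeg W y) (residual-outDeg W y) (Res.walk-conserves W-walk y)

      open FlowDecomposition tl hd (_∈ G) r w using (Decomposition; decomposition; decompose)

      augmentation-from : Decomposition (suc (length ps)) rerouted → Augmentation W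
      augmentation-from (decomposition qs len qs-walks qs# qs⊆ qs-last) =
        let ps′ , ps′-paths , ps′# , len′ , lasts , _ = walks⇒paths r≢w qs qs-walks qs# (anti-mono qs⊆ rerouted-tl≢w)
            into-rerouted : ∀ {g} → g ∈ₗ rerouted → hd g ≡ w → Any (IsLast g) ps′
            into-rerouted g∈ hd≡w = lasts (qs-last g∈ hd≡w)
        in  augmentation ps′ (All.map arcPath⇒path ps′-paths , ps′#) (trans len′ len) λ where
              (inj₁ g-last) → let p , p∈ , g-last-p = find g-last
                                  g∈ , hd≡w = ∈-edges p∈ g-last-p
                              in  into-rerouted (∈-++⁺ˡ (∈-filter⁺ (_∉ₗ? B) g∈ (λ g∈B → proj₂ (b-valid g∈B) hd≡w))) hd≡w
              (inj₂ g-last) →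
                into-rerouted (∈-++⁺ʳ Rem (∈-forwards⁺ W (IsLast⇒∈ g-last))) (Res.last-arc-target W-walk g-last)

      augmentation-along : Augmentation W
      augmentation-along =
        augmentation-from (decompose (suc (length ps)) rerouted rerouted! rerouted⊆G rerouted-tl≢w rerouted-conserves)

    augment : ∀ {W} → Res.ArcPath Valid r w W → Augmentation W
    augment = Rerouting.augmentation-along

    augment-to-sink : reachable w ≡ true → ∃ λ W → Augmentation W
    augment-to-sink w-reached with reachable⇒walk w w-reached
    ... | _ , walk with Res.walk⇒path walk
    ...   | W , path , _ = W , augment path

    maximal⇒sink-unreachable : (∀ ps′ → DisjointPaths U G r w ps′ → length ps′ ≤ length ps) → reachable w ≡ false
    maximal⇒sink-unreachable ps-max with reachable w in w-reached
    ... | false = refl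
    ... | true  = ⊥-elim (no-augmentation (proj₂ (augment-to-sink w-reached)))
      where
      no-augmentation : ∀ {W} → Augmentation W → ⊥
      no-augmentation (augmentation ps′ sys′ one-more _) = 1+n≰n (subst (_≤ length ps) one-more (ps-max ps′ sys′))

  LastEdgesCover : Subset m → List (List (Edge U)) → Set
  LastEdgesCover S P = ∀ f → f ∈ S → Any (IsLast f) P

  EndsIn : Subset m → List (Edge U) → Set
  EndsIn S p = ∃ λ f → IsLast f p × f ∈ S

  endsIn? : ∀ S → Decidable (EndsIn S)
  endsIn? S p with initLast p
  ... | [] = no λ (_ , f-last , _) → ¬Any[] (IsLast⇒∈ f-last)
  ... | pre ∷ʳ′ f with f ∈? S
  ...   | yes f∈S = yes (f , (pre , refl) , f∈S)
  ...   | no  f∉S = no λ (f′ , f′-last , f′∈S) → f∉S (subst (_∈ S) (IsLast-unique f′-last (pre , refl)) f′∈S)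

  trim : ∀ {G r w S P} → DisjointPaths U G r w P → LastEdgesCover S P → (∀ f → f ∈ S → f ∈ G × hd f ≡ w) →
    InG U G r w S
  trim {S = S} {P} (paths , P#) cover S-heads =
    S-heads , filter (endsIn? S) P , (All.filter⁺ (endsIn? S) paths , AllPairs.filter⁺ (endsIn? S) P#) ,
    λ f → mk⇔ (to f) (from f)
    where
    to : ∀ f → f ∈ S → Any (IsLast f) (filter (endsIn? S) P)
    to f f∈S with find (cover f f∈S)
    ... | p , p∈P , f-last = lose (∈-filter⁺ (endsIn? S) p∈P (f , f-last , f∈S)) f-last
    from : ∀ f → Any (IsLast f) (filter (endsIn? S) P) → f ∈ S
    from f f-last-in with find f-last-in
    ... | p , p∈ , f-last with proj₂ (∈-filter⁻ (endsIn? S) {xs = P} p∈)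
    ...   | f′ , f′-last , f′∈S = subst (_∈ S) (IsLast-unique f′-last f-last) f′∈S

  module Uncrossing {G : Subset m} {r u v : Fin n} (r≢u : r ≢ u) (r≢v : r ≢ v)
                    {P₀ P : List (List (Edge U))} (sys₀ : DisjointPaths U G r u P₀) (sys : DisjointPaths U G r v P) where
    module X = Residual G r u r≢u P₀ sys₀
    module Y = Residual G r v r≢v P sys

    -- By submodularity X ∩ Y is a cut for P₀ no larger than X, hence tight, hence closed in the residual graph of P₀.
    reachable-⊆ : X.reachable u ≡ false → X.reachable v ≡ false → Y.reachable v ≡ false →
      ∀ t → X.reachable t ≡ true → Y.reachable t ≡ true
    reachable-⊆ Xu Xv Yv t Xt = proj₂ (∧-true⁻ (X.reachable-least X∩Y X∩Y-r X∩Y-closed t Xt))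
      where
      X∩Y X∪Y : Fin n → Bool
      X∩Y x = X.reachable x ∧ Y.reachable x
      X∪Y x = X.reachable x ∨ Y.reachable x

      X∩Y-r : X∩Y r ≡ true
      X∩Y-r rewrite X.reachable-start | Y.reachable-start = refl
      X∩Y-u : X∩Y u ≡ false
      X∩Y-u rewrite Xu = refl
      X∪Y-r : X∪Y r ≡ true
      X∪Y-r rewrite X.reachable-start = refl
      X∪Y-v : X∪Y v ≡ false
      X∪Y-v rewrite Xv | Yv = refl

      cut∩≤P₀ : cut-size G X∩Y ≤ length P₀
      cut∩≤P₀ = +-cancelʳ-≤ (length P) _ _ (begin
        cut-size G X∩Y + length P              ≤⟨ +-monoʳ-≤ (cut-size G X∩Y) (≤-trans (m≤m+n _ _) (paths+entering≤cut-size sys X∪Y X∪Y-r X∪Y-v)) ⟩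
        cut-size G X∩Y + cut-size G X∪Y         ≤⟨ cut-submodular G X.reachable Y.reachable ⟩
        cut-size G X.reachable + cut-size G Y.reachable ≤⟨ +-mono-≤ (X.cut-size≤paths Xu) (Y.cut-size≤paths Yv) ⟩
        length P₀ + length P                    ∎)
        where open ≤-Reasoning

      none-entering : ∀ {g} → g ∈ₗ concat P₀ → enters X∩Y g ≡ false
      none-entering = proj₁ (tight-cut sys₀ X∩Y X∩Y-r X∩Y-u cut∩≤P₀)

      leaving-used : ∀ {g} → g ∈ G → leaves X∩Y g ≡ true → g ∈ₗ concat P₀
      leaving-used = proj₂ (tight-cut sys₀ X∩Y X∩Y-r X∩Y-u cut∩≤P₀)

      X∩Y-closed : ∀ a → X.Valid a → X∩Y (rsrc a) ≡ true → X∩Y (rtgt a) ≡ true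
      X∩Y-closed (forward g) (g∈G , g∉ , _) tl-in with X∩Y (hd g) in hd-in
      ... | true  = refl
      ... | false = ⊥-elim (g∉ (leaving-used g∈G (∧-true⁺ tl-in (cong not hd-in))))
      X∩Y-closed (backward g) (g∈ , _) hd-in with X∩Y (tl g) in tl-in | none-entering g∈
      ... | true  | _ = refl
      ... | false | not-entering with () ← trans (sym not-entering) (∧-true⁺ refl hd-in)

  module Coloop (r : Fin n) (H D : Subset m) (D-loopless : Loopless U D) (D-r : NoHeadAt U r D)
                (u : Fin n) (r≢u : r ≢ u) (P₀ : List (List (Edge U))) (sys₀ : DisjointPaths U H r u P₀)
                (P₀-max : ∀ ps → DisjointPaths U H r u ps → length ps ≤ length P₀) where
    module X = Residual H r u r≢u P₀ sys₀

    u-unreachable : X.reachable u ≡ false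
    u-unreachable = X.maximal⇒sink-unreachable P₀-max

    -- More paths than the cut of X can carry in H force a D-path through an edge outside H leaving X.
    outside-crossings>0 : ∀ {Q} (sysQ : DisjointPaths U D r u Q) → length P₀ < length Q →
      0 < count (λ g → not (does (g ∈? H)) ∧ leaves X.reachable g) (PathSystem.edges sysQ)
    outside-crossings>0 {Q} sysQ P₀<Q = n≢0⇒n>0 λ outside≡0 → <⇒≱ P₀<Q (begin
      length Q                                        ≤⟨ m≤m+n _ _ ⟩
      length Q + count (enters X.reachable) edges     ≡⟨ walks-crossings X.reachable X.reachable-start u-unreachable walks ⟨
      count (leaves X.reachable) edges                ≡⟨ count-split (λ g → does (g ∈? H)) _ edges ⟩
      inside + outside                                ≡⟨ cong (inside +_) outside≡0 ⟩
      inside + 0                                      ≡⟨ +-identityʳ _ ⟩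
      inside                                          ≤⟨ count-mono-unique edges edges! (λ {g} _ h → ∈-allFin g , h) ⟩
      cut-size H X.reachable                          ≤⟨ X.cut-size≤paths u-unreachable ⟩
      length P₀                                       ∎)
      where
      open PathSystem sysQ
      open ≤-Reasoning
      inside outside : ℕ
      inside  = count (λ g → does (g ∈? H) ∧ leaves X.reachable g) edges
      outside = count (λ g → not (does (g ∈? H)) ∧ leaves X.reachable g) edges

    crossing-edge : ∀ {Q} → DisjointPaths U D r u Q → length P₀ < length Q →
      ∃ λ e → e ∈ D × e ∉ H × X.reachable (tl e) ≡ true × X.reachable (hd e) ≡ false
    crossing-edge {Q} sysQ P₀<Q with count>0⇒true _ (PathSystem.edges sysQ) (outside-crossings>0 sysQ P₀<Q)
    ... | e , e∈ , h with ∧-true⁻ h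
    ...   | e∉H , lv with ∧-true⁻ lv
    ...     | Xt , Xv = e , All.lookup (PathSystem.edges⊆G sysQ) e∈ , does⇒¬ (e ∈? H) (not-true⁻ e∉H) , Xt , not-true⁻ Xv

    module _ (e : Edge U) (e∈D : e ∈ D) (e∉H : e ∉ H)
             (Xt : X.reachable (tl e) ≡ true) (Xv : X.reachable (hd e) ≡ false) where
      v t : Fin n
      v = hd e
      t = tl e

      r≢v : r ≢ v
      r≢v r≡v = D-r e e∈D (sym r≡v)

      H+e : Subset m
      H+e = H ∪ ⁅ e ⁆

      H⊆H+e : ∀ {g} → g ∈ H → g ∈ H+e
      H⊆H+e = p⊆p∪q ⁅ e ⁆

      e∈H+e : e ∈ H+e
      e∈H+e = q⊆p∪q H ⁅ e ⁆ (x∈⁅x⁆ e)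

      Extension : Subset m → Set
      Extension I = ∃ λ P → DisjointPaths U H+e r v P × LastEdgesCover (I ∪ ⁅ e ⁆) P

      module Step {P : List (List (Edge U))} (sys : DisjointPaths U H r v P) where
        module Y  = Residual H   r v r≢v P sys
        module Y⁺ = Residual H+e r v r≢v P (system-mono H⊆H+e sys)

        valid⁺ : ∀ {a} → Y.Valid a → Y⁺.Valid a
        valid⁺ {forward _}  (g∈H , rest) = H⊆H+e g∈H , rest
        valid⁺ {backward _} valid        = valid

        e-valid : Y⁺.Valid (forward e)
        e-valid = e∈H+e , (λ e∈ → e∉H (All.lookup (PathSystem.edges⊆G sys) e∈)) , D-loopless e e∈D

        -- A residual walk to t followed by e is an augmenting path in H + e ending with e.
        through-e : ∀ {I} → LastEdgesCover I P → Y.reachable t ≡ true → Extension I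
        through-e {I} cover Yt with Y.reachable⇒walk t Yt
        ... | W₀ , walk₀ with Res.walk-snoc (Res.walk-map valid⁺ walk₀) e-valid refl
        ...   | walk₁ with Res.walk⇒path walk₁
        ...     | W , (pw , pw!) , W⊆W₁ = extension (Y⁺.augment (pw , pw!))
          where
          e-last : IsLast (forward e) W
          e-last = Res.path-keeps-last-arc r≢v walk₁
            (All.map (λ {a} → Y⁺.valid-rsrc≢w a) (Res.walk-ok walk₁)) pw W⊆W₁ (W₀ , refl)
          extension : Y⁺.Augmentation W → Extension I
          extension (Y⁺.augmentation P′ sys′ _ keeps) = P′ , sys′ , cover′
            where
            cover′ : LastEdgesCover (I ∪ ⁅ e ⁆) P′
            cover′ f f∈ with x∈p∪q⁻ I ⁅ e ⁆ f∈
            ... | inj₁ f∈I = keeps (inj₁ (cover f f∈I))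
            ... | inj₂ f∈e rewrite x∈⁅y⁆⇒x≡y e f∈e = keeps (inj₂ e-last)

      -- Augment inside H while v stays reachable; otherwise uncrossing makes t reachable.
      extend : ∀ I fuel {P} (sys : DisjointPaths U H r v P) → LastEdgesCover I P → m < length P + fuel → Extension I
      extend I zero {P} sys _ bound =
        ⊥-elim (<⇒≱ bound (subst (_≤ m) (sym (+-identityʳ (length P))) (PathSystem.length≤m sys r≢v)))
      extend I (suc fuel) {P} sys cover bound with Step.Y.reachable sys v in Yv
      ... | true = continue (proj₂ (Step.Y.augment-to-sink sys Yv))
        where
        continue : ∀ {W} → Step.Y.Augmentation sys W → Extension I
        continue (Residual.augmentation P′ sys′ one-more keeps) =
          extend I fuel sys′ (λ f f∈I → keeps (inj₁ (cover f f∈I)))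
            (subst (m <_) (trans (+-suc (length P) fuel) (cong (_+ fuel) (sym one-more))) bound)
      extend I (suc fuel) {P} sys cover bound | false =
        Step.through-e sys cover (Uncrossing.reachable-⊆ r≢u r≢v sys₀ sys u-unreachable Xv Yv t Xt)

      coloop : ∀ I → InG U H r v I → InG U H+e r v (I ∪ ⁅ e ⁆)
      coloop I (I-heads , P , sys , lasts⇔) with extend I (suc m) sys (λ f → Equivalence.to (lasts⇔ f)) bound
        where
        bound : m < length P + suc m
        bound = ≤-trans (n<1+n m) (m≤n+m (suc m) (length P))
      ... | P′ , sys′ , cover = trim sys′ cover heads
        where
        heads : ∀ f → f ∈ I ∪ ⁅ e ⁆ → f ∈ H+e × hd f ≡ v
        heads f f∈ with x∈p∪q⁻ I ⁅ e ⁆ f∈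
        ... | inj₁ f∈I = Data.Product.map₁ H⊆H+e (I-heads f f∈I)
        ... | inj₂ f∈e rewrite x∈⁅y⁆⇒x≡y e f∈e = e∈H+e , refl

    coloop-edge : ∀ {Q} → DisjointPaths U D r u Q → length P₀ < length Q →
      ∃ λ e → e ∈ D × e ∉ H × (∀ I → InG U H r (hd e) I → InG U (H ∪ ⁅ e ⁆) r (hd e) (I ∪ ⁅ e ⁆))
    coloop-edge sysQ P₀<Q with crossing-edge sysQ P₀<Q
    ... | e , e∈D , e∉H , Xt , Xv = e , e∈D , e∉H , coloop e e∈D e∉H Xt Xv

lemma3 : {n : ℕ} (U : EdgeUniverse n) (r : Fin n) (H D : Digraph U) →
    Loopless U H → Loopless U D → NoHeadAt U r H → NoHeadAt U r D →
    (u : Fin n) → u ≢ r →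
    (∃ λ k → ∃ λ l → IsLambda U H r u k × IsLambda U D r u l × k < l) →
    ∃ λ (e : Edge U) → e ∈ D × e ∉ H ×
      (∀ (I : Subset (EdgeUniverse.m U)) →
        InG U H r (EdgeUniverse.hd U e) I →
        InG U (H ∪ ⁅ e ⁆) r (EdgeUniverse.hd U e) (I ∪ ⁅ e ⁆))
lemma3 U r H D _ D-loopless _ D-r u u≢r (_ , _ , ((P₀ , sys₀ , refl) , P₀-max) , ((Q , sysQ , refl) , _) , P₀<Q) =
  Digraphs.Coloop.coloop-edge U r H D D-loopless D-r u (u≢r ∘ sym) P₀ sys₀ P₀-max sysQ P₀<Q
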